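{- Let \[ \mathcal P=\Big\{\begin{pmatrix}a_1&e_1\\1&0\end{pmatrix}\begin{pmatrix}a_2&e_2\\1&0\end{pmatrix}\cdots\begin{pmatrix}a_n&e_n\\1&0\end{pmatrix}\ \Big|\ n\ge1,\ a_i\in2\mathbb N-1,\ e_i=\pm1,\ a_i+e_i\ge2\Big\}, \] \[ \mathcal S_{+1}=\Big\{\begin{pmatrix}a&b\\c&d\end{pmatrix}\in\widetilde\Gamma\ \Big|\ 0\le d\le b,\ 1\le c\le a,\ a/b>g\Big\},\quad \mathcal S_{ -1}=\Big\{\begin{pmatrix}a&-b\\c&-d\end{pmatrix}\in\widetilde\Gamma\ \Big|\ 0\le d\le b,\ 1\le c\le a,\ a/b>G+1\Big\}. \] Then $\mathcal P=\mathcal S_{+1}\cup\mathcal S_{ -1}$.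
   Context: $G=\frac{\sqrt5+1}{2}$, $g=\frac{\sqrt5-1}{2}$, $\mathbb N=\{1,2,\dots\}$. Let $I=\begin{pmatrix}1&0\\0&1\end{pmatrix}$, $A=\begin{pmatrix}0&1\\1&1\end{pmatrix}$, $B=\begin{pmatrix}1&1\\1&0\end{pmatrix}$, and $\widetilde\Gamma=\{\sigma\in\mathrm{GL}(2,\mathbb Z)\mid \sigma\equiv I,\ A\text{ or }B \pmod 2\}$ (entrywise congruence). Matrix entries $a,b,c,d$ are integers. -}

module Defs where

open import Data.Nat using (ℕ)
open import Data.Integer using (ℤ; +_; -_; _+_; _-_; _*_; _≤_; _<_; 0ℤ; 1ℤ; -1ℤ)
open import Data.Integer.Divisibility using (_∣_)
open import Data.List using (List; []; _∷_)
open import Data.List.Relation.Unary.All using (All)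
open import Data.Product using (Σ; ∃; _×_; _,_)
open import Data.Sum using (_⊎_)
open import Relation.Binary.PropositionalEquality using (_≡_)

record Mat : Set where
  constructor mat
  field
    a b c d : ℤ
open Mat public

_⊗_ : Mat → Mat → Mat
mat a b c d ⊗ mat a' b' c' d' =
  mat (a * a' + b * c') (a * b' + b * d') (c * a' + d * c') (c * b' + d * d')

det : Mat → ℤ
det (mat a b c d) = a * d - b * c

I A B : Mat
I = mat 1ℤ 0ℤ 0ℤ 1ℤ
A = mat 0ℤ 1ℤ 1ℤ 1ℤ
B = mat 1ℤ 1ℤ 1ℤ 0ℤ

_≡₂_ : ℤ → ℤ → Set
x ≡₂ y = (+ 2) ∣ (x - y)

_≡M₂_ : Mat → Mat → Set
mat a b c d ≡M₂ mat a' b' c' d' = (a ≡₂ a') × (b ≡₂ b') × (c ≡₂ c') × (d ≡₂ d')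

InGL : Mat → Set
InGL σ = (det σ ≡ 1ℤ) ⊎ (det σ ≡ -1ℤ)

InΓ̃ : Mat → Set
InΓ̃ σ = InGL σ × ((σ ≡M₂ I) ⊎ (σ ≡M₂ A) ⊎ (σ ≡M₂ B))

digitMat : ℤ × ℤ → Mat
digitMat (x , e) = mat x e 1ℤ 0ℤ

Admissible : ℤ × ℤ → Set
Admissible (x , e) =
  (∃ λ (k : ℕ) → x ≡ + (2 Data.Nat.* k Data.Nat.+ 1))
  × ((e ≡ 1ℤ) ⊎ (e ≡ -1ℤ))
  × (+ 2 ≤ x + e)

digitsProd : ℤ × ℤ → List (ℤ × ℤ) → Mat
digitsProd p [] = digitMat p
digitsProd p (q ∷ qs) = digitMat p ⊗ digitsProd q qs

Inℙ : Mat → Set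
Inℙ M = Σ (ℤ × ℤ) λ p → Σ (List (ℤ × ℤ)) λ ps →
  Admissible p × All Admissible ps × (M ≡ digitsProd p ps)

-- a/b > g where g = (√5-1)/2, for integers a ≥ 1, b ≥ 0 (so a/b is read with b > 0):
--   b > 0  and  2a + b > √5 b  ⇔  b > 0 and (2a+b)^2 > 5 b^2   (as 2a+b > 0)
RatioGtg : ℤ → ℤ → Set
RatioGtg a b = (0ℤ < b) × ((+ 5) * (b * b) < (+ 2 * a + b) * (+ 2 * a + b))

-- a/b > G+1 where G+1 = (√5+3)/2:
--   b > 0  and  2a - 3b > √5 b  ⇔  b > 0, 2a - 3b > 0 and (2a-3b)^2 > 5 b^2
RatioGtG1 : ℤ → ℤ → Set
RatioGtG1 a b = (0ℤ < b) × (0ℤ < + 2 * a - + 3 * b)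
  × ((+ 5) * (b * b) < (+ 2 * a - + 3 * b) * (+ 2 * a - + 3 * b))

InS₊ : Mat → Set
InS₊ M = InΓ̃ M × (0ℤ ≤ d M) × (d M ≤ b M) × (1ℤ ≤ c M) × (c M ≤ a M)
  × RatioGtg (a M) (b M)

InS₋ : Mat → Set
InS₋ M = Σ ℤ λ x → Σ ℤ λ y → Σ ℤ λ z → Σ ℤ λ w →
  (M ≡ mat x (- y) z (- w)) × InΓ̃ M
  × (0ℤ ≤ w) × (w ≤ y) × (1ℤ ≤ z) × (z ≤ x) × RatioGtG1 x y

{-# OPTIONS --safe #-}

-- Write the matrices of 𝒫 and 𝒮 as ( x  s·y ; z  s·w ) with s = ±1 and x, y, z, w ≥ 0.
-- Multiplying on the right by a digit ( a e ; 1 0 ) gives ( x a + s y  e·x ; z a + s w  e·z ),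
-- so the ratio r = x/y becomes a + s/r; the irrational bounds g and G + 1 are compared through
-- squares, e.g. p/x > g iff (2p + x)² > 5x².
--
-- 𝒫 ⊆ 𝒮: modulo 2 the matrices I, A, B form a group, so Γ̃ is closed under products, and it
-- contains the digits. The inequalities of 𝒮ₛ survive one more digit, provided that products
-- ending in a negative digit also satisfy w < z and y − w ≤ x − z, which is preserved as well.
--
-- 𝒮 ⊆ 𝒫: descent on x + 2y. If w = 0 the determinant forces the matrix to be one digit.
-- Otherwise take the odd a ≥ 1 (a ≥ 3 if s = −1) with r − a in the window (−g², G) of length 2
-- (√5 is irrational, and parity rules out r = a). Peeling off the digit ( a s ; 1 0 ) leaves
-- ( y  x − a y ; w  z − a w ), which by the determinant lies in 𝒮₊₁ if r > a and in 𝒮₋₁ if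
-- r < a, and has smaller x + 2y.
module Submission where

open import Defs
open import Data.Nat as ℕ using (ℕ; zero; suc)
import Data.Nat.Properties as ℕ
import Data.Nat.Tactic.RingSolver as ℕ-Solver
import Data.Nat.Divisibility as ℕ
open import Data.Nat.Induction using (<-rec)
open import Data.Nat.Primality using (Prime; prime?; euclidsLemma)
open import Data.Integer
  using (ℤ; +_; -[1+_]; -_; _+_; _-_; _*_; _≤_; _<_; 0ℤ; 1ℤ; -1ℤ; +≤+; +<+; -≤+; -<+; ∣_∣)
open import Data.Integer.Properties
open import Data.Integer.Tactic.RingSolver using (solve; solve-∀)
import Data.Integer.Divisibility.Signed as Signed
open import Data.List using ([]; _∷_; _++_)
open import Data.List.Relation.Unary.All as All using (All)
open import Data.List.Relation.Unary.All.Properties using (++⁺)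
open import Data.Product using (Σ; ∃; _×_; _,_; proj₁; proj₂)
open import Data.Sum using (_⊎_; inj₁; inj₂)
open import Data.Unit using (⊤; tt)
open import Data.Empty using (⊥; ⊥-elim)
open import Relation.Nullary using (¬_; Dec; yes; no)
open import Relation.Nullary.Decidable using (True; toWitness; toWitnessFalse; _×-dec_)
open import Relation.Binary.Definitions using (tri<; tri≈; tri>)
open import Relation.Binary.PropositionalEquality
open import Function using (_∘_)

0≤+ : ∀ n → 0ℤ ≤ + n
0≤+ _ = +≤+ ℕ.z≤n

+-nonNeg : ∀ {i j} → 0ℤ ≤ i → 0ℤ ≤ j → 0ℤ ≤ i + j
+-nonNeg = +-mono-≤

+-pos : ∀ {i j} → 0ℤ < i → 0ℤ ≤ j → 0ℤ < i + j
+-pos = +-mono-<-≤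

*-nonNeg : ∀ {i j} → 0ℤ ≤ i → 0ℤ ≤ j → 0ℤ ≤ i * j
*-nonNeg {+ m} {+ n} _ _ = subst (0ℤ ≤_) (pos-* m n) (0≤+ _)

*-pos : ∀ {i j} → 0ℤ < i → 0ℤ < j → 0ℤ < i * j
*-pos {+ suc m} {+ suc n} _ _ = subst (0ℤ <_) (pos-* (suc m) (suc n)) (+<+ ℕ.z<s)
*-pos {+ zero} (+<+ ())
*-pos {+ suc _} {+ zero} _ (+<+ ())

square-nonNeg : ∀ i → 0ℤ ≤ i * i
square-nonNeg (+ n)    = *-nonNeg (0≤+ n) (0≤+ n)
square-nonNeg -[1+ n ] = 0≤+ _

≤-by-gap : ∀ {i j} d → 0ℤ ≤ d → j ≡ i + d → i ≤ j
≤-by-gap {i} d 0≤d refl = subst (_≤ i + d) (+-identityʳ i) (+-monoʳ-≤ i 0≤d)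

<-by-gap : ∀ {i j} d → 0ℤ < d → j ≡ i + d → i < j
<-by-gap {i} d 0<d refl = subst (_< i + d) (+-identityʳ i) (+-monoʳ-< i 0<d)

i<j⇒0<j-i : ∀ {i j} → i < j → 0ℤ < j - i
i<j⇒0<j-i {i} {j} h = subst (_< j - i) (+-inverseʳ i) (+-monoˡ-< (- i) h)

<-by-equal-gap : ∀ {i j i′ j′} → i < j → j′ - i′ ≡ j - i → i′ < j′
<-by-equal-gap {i} {j} {i′} {j′} h eq =
  <-by-gap (j′ - i′) (subst (0ℤ <_) (sym eq) (i<j⇒0<j-i h)) (solve (i′ ∷ j′ ∷ []))

square-mono-≤ : ∀ {u v} → 0ℤ ≤ u → u ≤ v → u * u ≤ v * v
square-mono-≤ {u} {v} 0≤u u≤v =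
  ≤-by-gap _ (+-nonNeg (*-nonNeg 0≤v-u 0≤v-u) (*-nonNeg (0≤+ 2) (*-nonNeg 0≤u 0≤v-u)))
    (solve (u ∷ v ∷ []))
  where
  0≤v-u = i≤j⇒0≤j-i u≤v

square-<⇒< : ∀ {u v} → 0ℤ ≤ v → u * u < v * v → u < v
square-<⇒< {u} {v} 0≤v u²<v² with u <? v
... | yes u<v = u<v
... | no u≮v  = ⊥-elim (<⇒≱ u²<v² (square-mono-≤ 0≤v (≮⇒≥ u≮v)))

half-pos : ∀ t → 0ℤ < + 2 * t → 0ℤ < t
half-pos (+ suc _) _ = +<+ ℕ.z<s
half-pos (+ zero)  (+<+ ())

4y²≤5y² : ∀ y → (+ 2 * y) * (+ 2 * y) ≤ + 5 * (y * y)
4y²≤5y² y = ≤-by-gap (y * y) (square-nonNeg y) (solve (y ∷ []))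

*-cancelˡ-≤-pos′ : ∀ {y i j} → 0ℤ < y → y * i ≤ y * j → i ≤ j
*-cancelˡ-≤-pos′ {+ suc n} {i} {j} _ = *-cancelˡ-≤-pos i j (+ suc n)
*-cancelˡ-≤-pos′ {+ zero} (+<+ ())

i≤+∣i∣ : ∀ i → i ≤ + ∣ i ∣
i≤+∣i∣ (+ _)    = ≤-refl
i≤+∣i∣ -[1+ _ ] = -≤+

<-≤-pred : ∀ {i j n} → i < j → j ≤ + suc n → i ≤ + n
<-≤-pred i<j j≤1+n = i<j⇒i≤pred[j] (<-≤-trans i<j j≤1+n)

IsUnit : ℤ → Set
IsUnit u = (u ≡ 1ℤ) ⊎ (u ≡ -1ℤ)

IsUnit-* : ∀ {i j} → IsUnit i → IsUnit j → IsUnit (i * j)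
IsUnit-* (inj₁ refl) (inj₁ refl) = inj₁ refl
IsUnit-* (inj₁ refl) (inj₂ refl) = inj₂ refl
IsUnit-* (inj₂ refl) (inj₁ refl) = inj₂ refl
IsUnit-* (inj₂ refl) (inj₂ refl) = inj₁ refl

IsUnit-neg : ∀ {i} → IsUnit i → IsUnit (- i)
IsUnit-neg (inj₁ refl) = inj₂ refl
IsUnit-neg (inj₂ refl) = inj₁ refl

IsUnit-resp : ∀ {i j} → i ≡ j → IsUnit i → IsUnit j
IsUnit-resp refl u = u

IsUnit⇒≤1 : ∀ {i} → IsUnit i → i ≤ 1ℤ
IsUnit⇒≤1 (inj₁ refl) = ≤-refl
IsUnit⇒≤1 (inj₂ refl) = -≤+

positive-unit-factor : ∀ {i j} → 0ℤ < i → IsUnit (i * j) → i ≡ 1ℤ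
positive-unit-factor {i} {j} 0<i u =
  trans (sym (0≤i⇒+∣i∣≡i (<⇒≤ 0<i)))
        (cong +_ (ℕ.m*n≡1⇒m≡1 ∣ i ∣ ∣ j ∣ (trans (sym (abs-* i j)) (abs-unit u))))
  where
  abs-unit : ∀ {k} → IsUnit k → ∣ k ∣ ≡ 1
  abs-unit (inj₁ refl) = refl
  abs-unit (inj₂ refl) = refl

-- √5 is irrational

prime-5 : Prime 5
prime-5 = toWitness {a? = prime? 5} tt

5∣²⇒5∣ : ∀ m → 5 ℕ.∣ m ℕ.* m → 5 ℕ.∣ m
5∣²⇒5∣ m 5∣m² with euclidsLemma m m prime-5 5∣m²
... | inj₁ 5∣m = 5∣m
... | inj₂ 5∣m = 5∣m

-- Infinite descent: m² = 5n² with n > 0 gives m = 5m′, n = 5n′ and m′² = 5n′².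
√5-irrational-ℕ : ∀ n {m} → m ℕ.* m ≡ 5 ℕ.* (n ℕ.* n) → n ≡ 0
√5-irrational-ℕ = <-rec _ descent
  where
  square-*5 : ∀ u → u ℕ.* 5 ℕ.* (u ℕ.* 5) ≡ 5 ℕ.* (5 ℕ.* (u ℕ.* u))
  square-*5 = ℕ-Solver.solve-∀
  descent : ∀ n → (∀ {k} → k ℕ.< n → ∀ {m} → m ℕ.* m ≡ 5 ℕ.* (k ℕ.* k) → k ≡ 0) →
            ∀ {m} → m ℕ.* m ≡ 5 ℕ.* (n ℕ.* n) → n ≡ 0
  descent zero      _   _ = refl
  descent n@(suc _) rec {m} m²≡5n²
    with 5∣²⇒5∣ m (ℕ.divides (n ℕ.* n) (trans m²≡5n² (ℕ.*-comm 5 (n ℕ.* n))))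
  ... | ℕ.divides m′ refl =
    from-5∣n (5∣²⇒5∣ n (ℕ.divides (m′ ℕ.* m′) (trans (sym 5m′²≡n²) (ℕ.*-comm 5 (m′ ℕ.* m′)))))
    where
    5m′²≡n² : 5 ℕ.* (m′ ℕ.* m′) ≡ n ℕ.* n
    5m′²≡n² = ℕ.*-cancelˡ-≡ (5 ℕ.* (m′ ℕ.* m′)) (n ℕ.* n) 5 (trans (sym (square-*5 m′)) m²≡5n²)
    from-5∣n : 5 ℕ.∣ n → n ≡ 0
    from-5∣n (ℕ.divides zero ())
    from-5∣n (ℕ.divides n′@(suc _) n≡n′*5) = ⊥-elim (ℕ.1+n≢0 (rec n′<n {m′} m′²≡5n′²))
      where
      n′<n = subst (n′ ℕ.<_) (sym n≡n′*5) (ℕ.m<m*n n′ 5 (ℕ.s≤s (ℕ.s≤s ℕ.z≤n)))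
      m′²≡5n′² = ℕ.*-cancelˡ-≡ (m′ ℕ.* m′) (5 ℕ.* (n′ ℕ.* n′)) 5
                   (trans 5m′²≡n² (trans (cong (λ t → t ℕ.* t) n≡n′*5) (square-*5 n′)))

√5-irrational : ∀ s t → s * s ≡ + 5 * (t * t) → t ≡ 0ℤ
√5-irrational s t eq = ∣i∣≡0⇒i≡0 (√5-irrational-ℕ ∣ t ∣ {∣ s ∣} (begin
  ∣ s ∣ ℕ.* ∣ s ∣           ≡⟨ abs-* s s ⟨
  ∣ s * s ∣                 ≡⟨ cong ∣_∣ eq ⟩
  ∣ + 5 * (t * t) ∣         ≡⟨ abs-* (+ 5) (t * t) ⟩
  5 ℕ.* ∣ t * t ∣           ≡⟨ cong (5 ℕ.*_) (abs-* t t) ⟩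
  5 ℕ.* (∣ t ∣ ℕ.* ∣ t ∣)   ∎))
  where open ≡-Reasoning

-- Γ̃ is closed under products

mat-cong : ∀ {p q r s p′ q′ r′ s′} → p ≡ p′ → q ≡ q′ → r ≡ r′ → s ≡ s′ →
           mat p q r s ≡ mat p′ q′ r′ s′
mat-cong refl refl refl refl = refl

⊗-assoc : ∀ M N P → M ⊗ (N ⊗ P) ≡ (M ⊗ N) ⊗ P
⊗-assoc (mat a b c d) (mat a′ b′ c′ d′) (mat a″ b″ c″ d″) =
  mat-cong (entry a b a″ c″) (entry a b b″ d″) (entry c d a″ c″) (entry c d b″ d″)
  where
  entry : ∀ x y p q → x * (a′ * p + b′ * q) + y * (c′ * p + d′ * q)
                      ≡ (x * a′ + y * c′) * p + (x * b′ + y * d′) * q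
  entry x y p q = solve (x ∷ y ∷ p ∷ q ∷ a′ ∷ b′ ∷ c′ ∷ d′ ∷ [])

det-⊗ : ∀ M N → det (M ⊗ N) ≡ det M * det N
det-⊗ (mat a b c d) (mat a′ b′ c′ d′) = expand a b c d a′ b′ c′ d′
  where
  expand : ∀ a b c d a′ b′ c′ d′ →
           (a * a′ + b * c′) * (c * b′ + d * d′) - (a * b′ + b * d′) * (c * a′ + d * c′)
           ≡ (a * d - b * c) * (a′ * d′ - b′ * c′)
  expand = solve-∀

InGL-⊗ : ∀ {M N} → InGL M → InGL N → InGL (M ⊗ N)
InGL-⊗ {M} {N} gM gN = IsUnit-resp (sym (det-⊗ M N)) (IsUnit-* gM gN)

≡₂-by-sum : ∀ x y u v → x - y ≡ u + v → + 2 Signed.∣ u → + 2 Signed.∣ v → x ≡₂ y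
≡₂-by-sum _ _ u v eq 2∣u 2∣v =
  Signed.∣⇒∣ᵤ (subst (+ 2 Signed.∣_) (sym eq) (Signed.∣m∣n⇒∣m+n 2∣u 2∣v))

≡₂-by : ∀ x y q → x - y ≡ q * + 2 → x ≡₂ y
≡₂-by _ _ q eq = Signed.∣⇒∣ᵤ (Signed.divides q eq)

≡₂-sym : ∀ x y → x ≡₂ y → y ≡₂ x
≡₂-sym x y h = ≡₂-by-sum y x (- (x - y)) 0ℤ (solve (x ∷ y ∷ []))
  (Signed.∣m⇒∣-m (Signed.∣ᵤ⇒∣ h)) (Signed.divides 0ℤ refl)

≡₂-trans : ∀ x y z → x ≡₂ y → y ≡₂ z → x ≡₂ z
≡₂-trans x y z h k = ≡₂-by-sum x z (x - y) (y - z) (solve (x ∷ y ∷ z ∷ []))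
  (Signed.∣ᵤ⇒∣ h) (Signed.∣ᵤ⇒∣ k)

≡₂-+ : ∀ x y x′ y′ → x ≡₂ x′ → y ≡₂ y′ → (x + y) ≡₂ (x′ + y′)
≡₂-+ x y x′ y′ h k =
  ≡₂-by-sum (x + y) (x′ + y′) (x - x′) (y - y′) (solve (x ∷ y ∷ x′ ∷ y′ ∷ []))
  (Signed.∣ᵤ⇒∣ h) (Signed.∣ᵤ⇒∣ k)

≡₂-* : ∀ x y x′ y′ → x ≡₂ x′ → y ≡₂ y′ → (x * y) ≡₂ (x′ * y′)
≡₂-* x y x′ y′ h k = ≡₂-by-sum (x * y) (x′ * y′) (x * (y - y′)) ((x - x′) * y′)
  (solve (x ∷ y ∷ x′ ∷ y′ ∷ []))
  (Signed.∣n⇒∣m*n x (Signed.∣ᵤ⇒∣ k)) (Signed.∣m⇒∣m*n y′ (Signed.∣ᵤ⇒∣ {i = x - x′} h))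

_≡₂?_ : ∀ x y → Dec (x ≡₂ y)
x ≡₂? y = 2 ℕ.∣? ∣ x - y ∣

odd≢₂even : ∀ x → x ≡₂ 1ℤ → ¬ (x ≡₂ 0ℤ)
odd≢₂even x x≡1 x≡0 =
  toWitnessFalse {a? = 1ℤ ≡₂? 0ℤ} tt (≡₂-trans 1ℤ x 0ℤ (≡₂-sym x 1ℤ x≡1) x≡0)

_≡M₂?_ : ∀ M N → Dec (M ≡M₂ N)
mat x y z w ≡M₂? mat x′ y′ z′ w′ = x ≡₂? x′ ×-dec y ≡₂? y′ ×-dec z ≡₂? z′ ×-dec w ≡₂? w′

≡M₂-trans : ∀ M N P → M ≡M₂ N → N ≡M₂ P → M ≡M₂ P
≡M₂-trans (mat x y z w) (mat x′ y′ z′ w′) (mat x″ y″ z″ w″)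
          (a , b , c , d) (a′ , b′ , c′ , d′) =
  ≡₂-trans x x′ x″ a a′ , ≡₂-trans y y′ y″ b b′ ,
  ≡₂-trans z z′ z″ c c′ , ≡₂-trans w w′ w″ d d′

≡M₂-⊗ : ∀ M M′ N N′ → M ≡M₂ M′ → N ≡M₂ N′ → (M ⊗ N) ≡M₂ (M′ ⊗ N′)
≡M₂-⊗ (mat x y z w) (mat x′ y′ z′ w′) (mat p q r s) (mat p′ q′ r′ s′)
      (a , b , c , d) (a′ , b′ , c′ , d′) =
  entry x y p r x′ y′ p′ r′ a b a′ c′ , entry x y q s x′ y′ q′ s′ a b b′ d′ ,
  entry z w p r z′ w′ p′ r′ c d a′ c′ , entry z w q s z′ w′ q′ s′ c d b′ d′
  where
  entry : ∀ x y p r x′ y′ p′ r′ → x ≡₂ x′ → y ≡₂ y′ → p ≡₂ p′ → r ≡₂ r′ →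
          (x * p + y * r) ≡₂ (x′ * p′ + y′ * r′)
  entry x y p r x′ y′ p′ r′ hx hy hp hr =
    ≡₂-+ (x * p) (y * r) (x′ * p′) (y′ * r′) (≡₂-* x p x′ p′ hx hp) (≡₂-* y r y′ r′ hy hr)

-- Modulo 2, I, A and B form the cyclic group of order 3 generated by A.
data Residue : Set where
  ι α β : Residue

⟦_⟧ : Residue → Mat
⟦ ι ⟧ = I
⟦ α ⟧ = A
⟦ β ⟧ = B

_∙_ : Residue → Residue → Residue
ι ∙ r = r
α ∙ ι = α
α ∙ α = β
α ∙ β = ι
β ∙ ι = β
β ∙ α = ι
β ∙ β = α

⟦⟧-⊗ : ∀ r r′ → (⟦ r ⟧ ⊗ ⟦ r′ ⟧) ≡M₂ ⟦ r ∙ r′ ⟧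
⟦⟧-⊗ r r′ = toWitness {a? = (⟦ r ⟧ ⊗ ⟦ r′ ⟧) ≡M₂? ⟦ r ∙ r′ ⟧} (table r r′)
  where
  table : ∀ r r′ → True ((⟦ r ⟧ ⊗ ⟦ r′ ⟧) ≡M₂? ⟦ r ∙ r′ ⟧)
  table ι ι = tt
  table ι α = tt
  table ι β = tt
  table α ι = tt
  table α α = tt
  table α β = tt
  table β ι = tt
  table β α = tt
  table β β = tt

ReducesMod2 : Mat → Set
ReducesMod2 M = (M ≡M₂ I) ⊎ (M ≡M₂ A) ⊎ (M ≡M₂ B)

residue : ∀ M → ReducesMod2 M → Σ Residue λ r → M ≡M₂ ⟦ r ⟧
residue _ (inj₁ h)        = ι , h
residue _ (inj₂ (inj₁ h)) = α , h
residue _ (inj₂ (inj₂ h)) = β , h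

from-residue : ∀ {M} r → M ≡M₂ ⟦ r ⟧ → ReducesMod2 M
from-residue ι h = inj₁ h
from-residue α h = inj₂ (inj₁ h)
from-residue β h = inj₂ (inj₂ h)

ReducesMod2-⊗ : ∀ M N → ReducesMod2 M → ReducesMod2 N → ReducesMod2 (M ⊗ N)
ReducesMod2-⊗ M N hM hN with residue M hM | residue N hN
... | r , M≡r | r′ , N≡r′ = from-residue {M ⊗ N} (r ∙ r′)
  (≡M₂-trans (M ⊗ N) (⟦ r ⟧ ⊗ ⟦ r′ ⟧) ⟦ r ∙ r′ ⟧ (≡M₂-⊗ M ⟦ r ⟧ N ⟦ r′ ⟧ M≡r N≡r′) (⟦⟧-⊗ r r′))

InΓ̃-⊗ : ∀ M N → InΓ̃ M → InΓ̃ N → InΓ̃ (M ⊗ N)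
InΓ̃-⊗ M N (gM , rM) (gN , rN) = InGL-⊗ {M} {N} gM gN , ReducesMod2-⊗ M N rM rN

IsUnit⇒odd : ∀ {e} → IsUnit e → e ≡₂ 1ℤ
IsUnit⇒odd (inj₁ refl) = toWitness {a? = 1ℤ ≡₂? 1ℤ} tt
IsUnit⇒odd (inj₂ refl) = toWitness {a? = -1ℤ ≡₂? 1ℤ} tt

neg-odd : ∀ x → x ≡₂ 1ℤ → (- x) ≡₂ 1ℤ
neg-odd x h = ≡₂-by-sum (- x) 1ℤ (- (x - 1ℤ)) (- + 2) (solve (x ∷ []))
  (Signed.∣m⇒∣-m (Signed.∣ᵤ⇒∣ {i = x - 1ℤ} h)) (Signed.divides -1ℤ refl)

odd-form : ∀ k → + (2 ℕ.* k ℕ.+ 1) ≡ + 2 * + k + 1ℤ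
odd-form k = trans (pos-+ (2 ℕ.* k) 1) (cong (_+ 1ℤ) (pos-* 2 k))

2t+1≡₂1 : ∀ t → (+ 2 * t + 1ℤ) ≡₂ 1ℤ
2t+1≡₂1 t = ≡₂-by (+ 2 * t + 1ℤ) 1ℤ t (solve (t ∷ []))

odd-form-odd : ∀ k → (+ (2 ℕ.* k ℕ.+ 1)) ≡₂ 1ℤ
odd-form-odd k = subst (_≡₂ 1ℤ) (sym (odd-form k)) (2t+1≡₂1 (+ k))

digit-Γ̃ : ∀ {a e} → a ≡₂ 1ℤ → IsUnit e → InΓ̃ (digitMat (a , e))
digit-Γ̃ {a} {e} a-odd e-unit =
  IsUnit-resp {i = - e} {j = a * 0ℤ - e * 1ℤ} (solve (a ∷ e ∷ [])) (IsUnit-neg e-unit) ,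
  inj₂ (inj₂ (a-odd , IsUnit⇒odd e-unit ,
              toWitness {a? = 1ℤ ≡₂? 1ℤ} tt , toWitness {a? = 0ℤ ≡₂? 0ℤ} tt))

digitInv : ℤ × ℤ → Mat
digitInv (a , e) = mat 0ℤ 1ℤ e (- (a * e))

digitInv-Γ̃ : ∀ {a e} → a ≡₂ 1ℤ → IsUnit e → InΓ̃ (digitInv (a , e))
digitInv-Γ̃ {a} {e} a-odd e-unit =
  IsUnit-resp {i = - e} {j = 0ℤ * - (a * e) - 1ℤ * e} (solve (a ∷ e ∷ [])) (IsUnit-neg e-unit) ,
  inj₂ (inj₁ (toWitness {a? = 0ℤ ≡₂? 0ℤ} tt , toWitness {a? = 1ℤ ≡₂? 1ℤ} tt , IsUnit⇒odd e-unit ,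
              neg-odd (a * e) (≡₂-* a e 1ℤ 1ℤ a-odd (IsUnit⇒odd e-unit))))

Admissible⇒odd : ∀ {a e} → Admissible (a , e) → a ≡₂ 1ℤ
Admissible⇒odd ((k , refl) , _) = odd-form-odd k

Admissible⇒1≤ : ∀ {a e} → Admissible (a , e) → 1ℤ ≤ a
Admissible⇒1≤ ((k , refl) , _) = +≤+ (ℕ.m≤n+m 1 (2 ℕ.* k))

Admissible⇒3≤ : ∀ {a} → Admissible (a , -1ℤ) → + 3 ≤ a
Admissible⇒3≤ {a} (_ , _ , 2≤a-1) = ≤-by-gap (a + -1ℤ - + 2) (i≤j⇒0≤j-i 2≤a-1) (solve (a ∷ []))

Admissible⇒Γ̃ : ∀ {q} → Admissible q → InΓ̃ (digitMat q)
Admissible⇒Γ̃ {a , e} adm@(_ , e-unit , _) = digit-Γ̃ {a} {e} (Admissible⇒odd {a} {e} adm) e-unit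

Admissible-+2 : ∀ {a e} → Admissible (a , e) → Admissible (a + + 2 , e)
Admissible-+2 {a} {e} ((k , a≡2k+1) , e-unit , 2≤a+e) =
  (suc k , trans (cong (λ t → t + + 2) a≡2k+1) (cong +_ (next-odd k))) , e-unit ,
  ≤-trans 2≤a+e (≤-by-gap (+ 2) (0≤+ 2) (solve (a ∷ e ∷ [])))
  where
  next-odd : ∀ k → 2 ℕ.* k ℕ.+ 1 ℕ.+ 2 ≡ 2 ℕ.* suc k ℕ.+ 1
  next-odd = ℕ-Solver.solve-∀

odd-form-of : ∀ {x} → 1ℤ ≤ x → x ≡₂ 1ℤ → ∃ λ k → x ≡ + (2 ℕ.* k ℕ.+ 1)
odd-form-of {x} 1≤x (ℕ.divides q ∣x-1∣≡q*2) = q , (begin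
  x                    ≡⟨ solve (x ∷ []) ⟩
  (x - 1ℤ) + 1ℤ        ≡⟨ cong (_+ 1ℤ) (trans (sym (0≤i⇒+∣i∣≡i (i≤j⇒0≤j-i 1≤x))) (cong +_ ∣x-1∣≡q*2)) ⟩
  + (q ℕ.* 2) + 1ℤ     ≡⟨ cong (λ t → + t + 1ℤ) (ℕ.*-comm q 2) ⟩
  + (2 ℕ.* q) + 1ℤ     ≡⟨ pos-+ (2 ℕ.* q) 1 ⟨
  + (2 ℕ.* q ℕ.+ 1)    ∎)
  where open ≡-Reasoning

digitsProd-snoc : ∀ p ps q → digitsProd p (ps ++ q ∷ []) ≡ digitsProd p ps ⊗ digitMat q
digitsProd-snoc p []       q = refl
digitsProd-snoc p (r ∷ rs) q =
  trans (cong (digitMat p ⊗_) (digitsProd-snoc r rs q))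
        (⊗-assoc (digitMat p) (digitsProd r rs) (digitMat q))

Inℙ-⊗-digit : ∀ {M q} → Inℙ M → Admissible q → Inℙ (M ⊗ digitMat q)
Inℙ-⊗-digit {q = q} (p , ps , adm-p , adm-ps , refl) adm-q =
  p , ps ++ q ∷ [] , adm-p , ++⁺ adm-ps (adm-q All.∷ All.[]) , sym (digitsProd-snoc p ps q)

data Sign : Set where
  pos neg : Sign

unit : Sign → ℤ
unit pos = 1ℤ
unit neg = -1ℤ

signed : Sign → ℤ → ℤ
signed pos x = x
signed neg x = - x

unit-IsUnit : ∀ s → IsUnit (unit s)
unit-IsUnit pos = inj₁ refl
unit-IsUnit neg = inj₂ refl

*-unit : ∀ s x → x * unit s ≡ signed s x
*-unit pos x = *-identityʳ x
*-unit neg x = trans (*-comm x -1ℤ) (-1*i≡-i x)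

unit-column : ∀ e u v → u * unit e + v * 0ℤ ≡ signed e u
unit-column e u v = trans (cong (_+_ (u * unit e)) (*-zeroʳ v)) (trans (+-identityʳ _) (*-unit e u))

signed-zero : ∀ s → signed s 0ℤ ≡ 0ℤ
signed-zero pos = refl
signed-zero neg = refl

signed-one : ∀ s {y} → y ≡ 1ℤ → signed s y ≡₂ 1ℤ
signed-one pos refl = toWitness {a? = 1ℤ ≡₂? 1ℤ} tt
signed-one neg refl = toWitness {a? = -1ℤ ≡₂? 1ℤ} tt

smat : Sign → ℤ → ℤ → ℤ → ℤ → Mat
smat s x y z w = mat x (signed s y) z (signed s w)

smat-det : ∀ s x y z w → InGL (smat s x y z w) → IsUnit (x * w - y * z)
smat-det pos x y z w unit = unit
smat-det neg x y z w unit =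
  IsUnit-resp {i = - (x * - w - - y * z)} {j = x * w - y * z} (solve (x ∷ y ∷ z ∷ w ∷ []))
              (IsUnit-neg unit)

det-at-w≡y : ∀ {x y z w} → w ≡ y → x * w - y * z ≡ y * (x - z)
det-at-w≡y {x} {y} {z} refl = solve (x ∷ y ∷ z ∷ [])

Ratio : Sign → ℤ → ℤ → Set
Ratio pos = RatioGtg
Ratio neg = RatioGtG1

Ratio⇒0< : ∀ s {x y} → Ratio s x y → 0ℤ < y
Ratio⇒0< pos = proj₁
Ratio⇒0< neg = proj₁

-- smat s x y z w ∈ 𝒮ₛ, with the sign of 𝒮₋₁ pulled out of the second column.
InS : Sign → ℤ → ℤ → ℤ → ℤ → Set
InS s x y z w = InΓ̃ (smat s x y z w) × (0ℤ ≤ w) × (w ≤ y) × (1ℤ ≤ z) × (z ≤ x) × Ratio s x y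

InS⇒𝒮 : ∀ s {x y z w} → InS s x y z w → InS₊ (smat s x y z w) ⊎ InS₋ (smat s x y z w)
InS⇒𝒮 pos h = inj₁ h
InS⇒𝒮 neg {x} {y} {z} {w} h = inj₂ (x , y , z , w , refl , h)

smallest-digit : Sign → ℤ
smallest-digit pos = 1ℤ
smallest-digit neg = + 3

1≤smallest-digit : ∀ s → 1ℤ ≤ smallest-digit s
1≤smallest-digit pos = ≤-refl
1≤smallest-digit neg = +≤+ (ℕ.s≤s ℕ.z≤n)

Admissible⇒smallest≤ : ∀ e {a} → Admissible (a , unit e) → smallest-digit e ≤ a
Admissible⇒smallest≤ pos {a} = Admissible⇒1≤ {a}
Admissible⇒smallest≤ neg = Admissible⇒3≤

smallest-digit-Admissible : ∀ s → Admissible (smallest-digit s , unit s)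
smallest-digit-Admissible pos = (0 , refl) , inj₁ refl , ≤-refl
smallest-digit-Admissible neg = (1 , refl) , inj₂ refl , ≤-refl

digit≡smat : ∀ e a → digitMat (a , unit e) ≡ smat e a 1ℤ 1ℤ 0ℤ
digit≡smat pos a = refl
digit≡smat neg a = refl

-- Every product of admissible digits lies in 𝒮₊₁ ∪ 𝒮₋₁

-- For p, x > 0: p/x > g iff 2p + x > √5 x, and p/x > G+1 iff 2p − 3x > √5 x.
stretch : Sign → ℤ → ℤ → ℤ
stretch pos p x = + 2 * p + x
stretch neg p x = + 2 * p - + 3 * x

Ratio-from : ∀ e {p x t} → 0ℤ < x → 0ℤ < t → + 5 * (x * x) < t * t → t ≤ stretch e p x →
             Ratio e p x
Ratio-from pos 0<x 0<t 5x²<t² t≤ = 0<x , <-≤-trans 5x²<t² (square-mono-≤ (<⇒≤ 0<t) t≤)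
Ratio-from neg 0<x 0<t 5x²<t² t≤ =
  0<x , <-≤-trans 0<t t≤ , <-≤-trans 5x²<t² (square-mono-≤ (<⇒≤ 0<t) t≤)

-- x (2ρ + 1), where ρ > g bounds the next ratio a + s y/x (a ≥ 1) from below:
-- ρ = 1 if s = pos and ρ = 1 − y/x if s = neg.
anchor : Sign → ℤ → ℤ → ℤ
anchor pos x _ = + 3 * x
anchor neg x y = + 3 * x - + 2 * y

anchor-bound : ∀ s {x y} → 0ℤ < x → 0ℤ ≤ y → Ratio s x y →
               0ℤ < anchor s x y × + 5 * (x * x) < anchor s x y * anchor s x y
anchor-bound pos {x} 0<x _ _ =
  *-pos {+ 3} (+<+ ℕ.z<s) 0<x ,
  <-by-gap {j = + 3 * x * (+ 3 * x)} (+ 4 * (x * x)) (*-pos {+ 4} (+<+ ℕ.z<s) (*-pos 0<x 0<x))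
    (solve (x ∷ []))
anchor-bound neg {x} {y} 0<x 0≤y (_ , 0<2x-3y , 5y²<[2x-3y]²) =
  <-by-gap {j = + 3 * x - + 2 * y} (+ 2 * x - + 3 * y + (x + y))
    (+-pos 0<2x-3y (+-nonNeg (<⇒≤ 0<x) 0≤y)) (solve (x ∷ y ∷ [])) ,
  <-by-equal-gap {i′ = + 5 * (x * x)} {j′ = (+ 3 * x - + 2 * y) * (+ 3 * x - + 2 * y)}
    5y²<[2x-3y]² (solve (x ∷ y ∷ []))

anchor-≤-stretch : ∀ s e {x y a} → 0ℤ ≤ x → 0ℤ ≤ y → smallest-digit e ≤ a →
                   anchor s x y ≤ stretch e (x * a + signed s y) x
anchor-≤-stretch pos pos {x} {y} {a} 0≤x 0≤y 1≤a =
  ≤-by-gap {+ 3 * x} {+ 2 * (x * a + y) + x} (+ 2 * (x * (a - 1ℤ)) + + 2 * y)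
    (+-nonNeg (*-nonNeg (0≤+ 2) (*-nonNeg 0≤x (i≤j⇒0≤j-i 1≤a))) (*-nonNeg (0≤+ 2) 0≤y))
    (solve (x ∷ y ∷ a ∷ []))
anchor-≤-stretch pos neg {x} {y} {a} 0≤x 0≤y 3≤a =
  ≤-by-gap {+ 3 * x} {+ 2 * (x * a + y) - + 3 * x} (+ 2 * (x * (a - + 3)) + + 2 * y)
    (+-nonNeg (*-nonNeg (0≤+ 2) (*-nonNeg 0≤x (i≤j⇒0≤j-i 3≤a))) (*-nonNeg (0≤+ 2) 0≤y))
    (solve (x ∷ y ∷ a ∷ []))
anchor-≤-stretch neg pos {x} {y} {a} 0≤x _ 1≤a =
  ≤-by-gap {+ 3 * x - + 2 * y} {+ 2 * (x * a - y) + x} (+ 2 * (x * (a - 1ℤ)))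
    (*-nonNeg (0≤+ 2) (*-nonNeg 0≤x (i≤j⇒0≤j-i 1≤a)))
    (solve (x ∷ y ∷ a ∷ []))
anchor-≤-stretch neg neg {x} {y} {a} 0≤x _ 3≤a =
  ≤-by-gap {+ 3 * x - + 2 * y} {+ 2 * (x * a - y) - + 3 * x} (+ 2 * (x * (a - + 3)))
    (*-nonNeg (0≤+ 2) (*-nonNeg 0≤x (i≤j⇒0≤j-i 3≤a)))
    (solve (x ∷ y ∷ a ∷ []))

-- The extra inequalities satisfied by products whose last digit is negative.
Margin : Sign → ℤ → ℤ → ℤ → ℤ → Set
Margin pos _ _ _ _ = ⊤
Margin neg x y z w = (w + 1ℤ ≤ z) × (y - w ≤ x - z)

next-column : ∀ s {x y z w a} → 0ℤ ≤ w → w ≤ y → 1ℤ ≤ z → z ≤ x → Margin s x y z w → 1ℤ ≤ a →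
              (1ℤ ≤ z * a + signed s w) × (z * a + signed s w ≤ x * a + signed s y)
next-column pos {x} {y} {z} {w} {a} 0≤w w≤y 1≤z z≤x _ 1≤a =
  ≤-by-gap {1ℤ} {z * a + w} ((z - 1ℤ) * a + (a - 1ℤ) + w)
    (+-nonNeg (+-nonNeg (*-nonNeg (i≤j⇒0≤j-i 1≤z) 0≤a) (i≤j⇒0≤j-i 1≤a)) 0≤w)
    (solve (x ∷ y ∷ z ∷ w ∷ a ∷ [])) ,
  ≤-by-gap {z * a + w} {x * a + y} ((x - z) * a + (y - w))
    (+-nonNeg (*-nonNeg (i≤j⇒0≤j-i z≤x) 0≤a) (i≤j⇒0≤j-i w≤y))
    (solve (x ∷ y ∷ z ∷ w ∷ a ∷ []))
  where
  0≤a = ≤-trans (0≤+ 1) 1≤a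
next-column neg {x} {y} {z} {w} {a} 0≤w w≤y 1≤z z≤x (w+1≤z , y-w≤x-z) 1≤a =
  ≤-by-gap {1ℤ} {z * a - w} ((z - (w + 1ℤ)) + z * (a - 1ℤ))
    (+-nonNeg (i≤j⇒0≤j-i w+1≤z) (*-nonNeg (≤-trans (0≤+ 1) 1≤z) (i≤j⇒0≤j-i 1≤a)))
    (solve (x ∷ y ∷ z ∷ w ∷ a ∷ [])) ,
  ≤-by-gap {z * a - w} {x * a - y} ((x - z) * (a - 1ℤ) + ((x - z) - (y - w)))
    (+-nonNeg (*-nonNeg (i≤j⇒0≤j-i z≤x) (i≤j⇒0≤j-i 1≤a)) (i≤j⇒0≤j-i y-w≤x-z))
    (solve (x ∷ y ∷ z ∷ w ∷ a ∷ []))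

next-margin : ∀ s e {x y z w a} → 0ℤ ≤ w → w ≤ y → 1ℤ ≤ z → z ≤ x → Margin s x y z w →
              smallest-digit e ≤ a → Margin e (x * a + signed s y) x (z * a + signed s w) z
next-margin s pos _ _ _ _ _ _ = tt
next-margin pos neg {x} {y} {z} {w} {a} 0≤w w≤y 1≤z z≤x _ 3≤a =
  ≤-by-gap {z + 1ℤ} {z * a + w} (z * (a - + 3) + + 2 * (z - 1ℤ) + 1ℤ + w)
    (+-nonNeg (+-nonNeg (+-nonNeg (*-nonNeg (≤-trans (0≤+ 1) 1≤z) (i≤j⇒0≤j-i 3≤a))
                                  (*-nonNeg (0≤+ 2) (i≤j⇒0≤j-i 1≤z))) (0≤+ 1)) 0≤w)
    (solve (x ∷ y ∷ z ∷ w ∷ a ∷ [])) ,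
  ≤-by-gap {x - z} {x * a + y - (z * a + w)} ((x - z) * (a - 1ℤ) + (y - w))
    (+-nonNeg (*-nonNeg (i≤j⇒0≤j-i z≤x) (i≤j⇒0≤j-i (≤-trans (1≤smallest-digit neg) 3≤a)))
              (i≤j⇒0≤j-i w≤y))
    (solve (x ∷ y ∷ z ∷ w ∷ a ∷ []))
next-margin neg neg {x} {y} {z} {w} {a} 0≤w w≤y 1≤z z≤x (w+1≤z , y-w≤x-z) 3≤a =
  ≤-by-gap {z + 1ℤ} {z * a - w} (z * (a - + 3) + (z - (w + 1ℤ)) + z)
    (+-nonNeg (+-nonNeg (*-nonNeg 0≤z (i≤j⇒0≤j-i 3≤a)) (i≤j⇒0≤j-i w+1≤z)) 0≤z)
    (solve (x ∷ y ∷ z ∷ w ∷ a ∷ [])) ,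
  ≤-by-gap {x - z} {x * a - y - (z * a - w)} ((x - z) * (a - + 3) + (x - z) + ((x - z) - (y - w)))
    (+-nonNeg (+-nonNeg (*-nonNeg (i≤j⇒0≤j-i z≤x) (i≤j⇒0≤j-i 3≤a)) (i≤j⇒0≤j-i z≤x))
              (i≤j⇒0≤j-i y-w≤x-z))
    (solve (x ∷ y ∷ z ∷ w ∷ a ∷ []))
  where
  0≤z = ≤-trans (0≤+ 1) 1≤z

smat-⊗-digit : ∀ s e x y z w a → smat s x y z w ⊗ digitMat (a , unit e)
                                  ≡ smat e (x * a + signed s y) x (z * a + signed s w) z
smat-⊗-digit s e x y z w a =
  mat-cong (cong (_+_ (x * a)) (*-identityʳ (signed s y))) (unit-column e x (signed s y))
           (cong (_+_ (z * a)) (*-identityʳ (signed s w))) (unit-column e z (signed s w))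

Invariant : Mat → Set
Invariant M = Σ Sign λ s → Σ ℤ λ x → Σ ℤ λ y → Σ ℤ λ z → Σ ℤ λ w →
  (M ≡ smat s x y z w) × InS s x y z w × Margin s x y z w

Invariant⇒𝒮 : ∀ {M} → Invariant M → InS₊ M ⊎ InS₋ M
Invariant⇒𝒮 (s , _ , _ , _ , _ , refl , inS , _) = InS⇒𝒮 s inS

Invariant-smat-⊗-digit : ∀ s e {x y z w a} → InS s x y z w → Margin s x y z w →
                         Admissible (a , unit e) → Invariant (smat s x y z w ⊗ digitMat (a , unit e))
Invariant-smat-⊗-digit s e {x} {y} {z} {w} {a} (γ , 0≤w , w≤y , 1≤z , z≤x , r) m adm =
  e , x * a + signed s y , x , z * a + signed s w , z , eq ,
  (subst InΓ̃ eq (InΓ̃-⊗ (smat s x y z w) (digitMat (a , unit e)) γ (Admissible⇒Γ̃ adm)) ,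
   ≤-trans (0≤+ 1) 1≤z , z≤x ,
   proj₁ column , proj₂ column ,
   Ratio-from e 0<x 0<t 5x²<t² (anchor-≤-stretch s e (<⇒≤ 0<x) (≤-trans 0≤w w≤y) a₀≤a)) ,
  next-margin s e 0≤w w≤y 1≤z z≤x m a₀≤a
  where
  eq = smat-⊗-digit s e x y z w a
  a₀≤a = Admissible⇒smallest≤ e adm
  1≤a = ≤-trans (1≤smallest-digit e) a₀≤a
  column = next-column s 0≤w w≤y 1≤z z≤x m 1≤a
  0<x = <-≤-trans (+<+ ℕ.z<s) (≤-trans 1≤z z≤x)
  0<t = proj₁ (anchor-bound s 0<x (≤-trans 0≤w w≤y) r)
  5x²<t² = proj₂ (anchor-bound s 0<x (≤-trans 0≤w w≤y) r)

Invariant-⊗-digit : ∀ {M q} → Invariant M → Admissible q → Invariant (M ⊗ digitMat q)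
Invariant-⊗-digit (s , _ , _ , _ , _ , refl , inS , m) adm@(_ , inj₁ refl , _) =
  Invariant-smat-⊗-digit s pos inS m adm
Invariant-⊗-digit (s , _ , _ , _ , _ , refl , inS , m) adm@(_ , inj₂ refl , _) =
  Invariant-smat-⊗-digit s neg inS m adm

Invariant-signed-digit : ∀ e {a} → Admissible (a , unit e) → Invariant (digitMat (a , unit e))
Invariant-signed-digit e {a} adm =
  e , a , 1ℤ , 1ℤ , 0ℤ , digit≡smat e a ,
  (subst InΓ̃ (digit≡smat e a) (Admissible⇒Γ̃ adm) , ≤-refl , 0≤+ 1 , ≤-refl ,
   ≤-trans (1≤smallest-digit e) a₀≤a ,
   Ratio-from e (+<+ ℕ.z<s) (+<+ ℕ.z<s) (toWitness {a? = + 5 <? + 9} tt)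
     (subst (λ p → + 3 ≤ stretch e p 1ℤ) (trans (+-identityʳ (1ℤ * a)) (*-identityˡ a))
            (anchor-≤-stretch pos e (0≤+ 1) (0≤+ 0) a₀≤a))) ,
  margin e a₀≤a
  where
  a₀≤a = Admissible⇒smallest≤ e adm
  margin : ∀ e → smallest-digit e ≤ a → Margin e a 1ℤ 1ℤ 0ℤ
  margin pos _ = tt
  margin neg 3≤a =
    ≤-refl ,
    ≤-by-gap {1ℤ} {a - 1ℤ} (a - + 3 + 1ℤ) (+-nonNeg (i≤j⇒0≤j-i 3≤a) (0≤+ 1)) (solve (a ∷ []))

Invariant-⊗-digits : ∀ {M p} ps → Invariant M → Admissible p → All Admissible ps →
                     Invariant (M ⊗ digitsProd p ps)
Invariant-⊗-digits []       inv adm-p All.[] = Invariant-⊗-digit inv adm-p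
Invariant-⊗-digits {M} {p} (q ∷ qs) inv adm-p (adm-q All.∷ adm-qs) =
  subst Invariant (sym (⊗-assoc M (digitMat p) (digitsProd q qs)))
        (Invariant-⊗-digits qs (Invariant-⊗-digit inv adm-p) adm-q adm-qs)

Invariant-digit : ∀ {q} → Admissible q → Invariant (digitMat q)
Invariant-digit adm@(_ , inj₁ refl , _) = Invariant-signed-digit pos adm
Invariant-digit adm@(_ , inj₂ refl , _) = Invariant-signed-digit neg adm

ℙ⇒Invariant : ∀ {M} → Inℙ M → Invariant M
ℙ⇒Invariant (p , []     , adm-p , All.[] , refl) = Invariant-digit adm-p
ℙ⇒Invariant (p , q ∷ qs , adm-p , adm-q All.∷ adm-qs , refl) =
  Invariant-⊗-digits qs (Invariant-digit adm-p) adm-q adm-qs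

-- Every matrix of 𝒮₊₁ ∪ 𝒮₋₁ is a product of admissible digits

-- For y > 0: k/y > −g² = 1 − G.
AboveFloor : ℤ → ℤ → Set
AboveFloor y k = (0ℤ ≤ k) ⊎ RatioGtG1 y (- k)

-- For y > 0: −g² < k/y < G. This interval has length 2, so with k = x − a y it holds for exactly
-- one odd a.
Window : ℤ → ℤ → Set
Window y k = RatioGtg y k ⊎ RatioGtG1 y (- k) ⊎ (k ≡ 0ℤ)

RatioGtG1-by-gap : ∀ y κ {i j} → 0ℤ < κ → 0ℤ < + 2 * y - + 3 * κ → i < j →
                   (+ 2 * y - + 3 * κ) * (+ 2 * y - + 3 * κ) - + 5 * (κ * κ) ≡ j - i → RatioGtG1 y κ
RatioGtG1-by-gap y κ 0<κ 0<t i<j eq = 0<κ , 0<t , <-by-equal-gap i<j eq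

AboveFloor-by : ∀ y k → (k < 0ℤ → RatioGtG1 y (- k)) → AboveFloor y k
AboveFloor-by _ k below with 0ℤ ≤? k
... | yes 0≤k = inj₁ 0≤k
... | no  k≱0 = inj₂ (below (≰⇒> k≱0))

AboveFloor-of-RatioGtg : ∀ {x y} → 0ℤ ≤ x → RatioGtg x y → AboveFloor y (x - y)
AboveFloor-of-RatioGtg {x} {y} 0≤x (0<y , 5y²<[2x+y]²) = AboveFloor-by y (x - y) λ k<0 →
  RatioGtG1-by-gap y (- (x - y)) (neg-mono-< k<0) 0<3x-y 5y²<[2x+y]² (solve (x ∷ y ∷ []))
  where
  2y<2x+y : + 2 * y < + 2 * x + y
  2y<2x+y = square-<⇒< (+-nonNeg (*-nonNeg (0≤+ 2) 0≤x) (<⇒≤ 0<y))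
                       (≤-<-trans (4y²≤5y² y) 5y²<[2x+y]²)
  0<3x-y : 0ℤ < + 2 * y - + 3 * (- (x - y))
  0<3x-y = <-by-gap (+ 2 * x + y - + 2 * y + x)
             (+-pos (i<j⇒0<j-i 2y<2x+y) 0≤x) (solve (x ∷ y ∷ []))

AboveFloor-of-RatioGtG1 : ∀ {x y} → RatioGtG1 x y → AboveFloor y (x - + 3 * y)
AboveFloor-of-RatioGtG1 {x} {y} (0<y , 0<2x-3y , 5y²<[2x-3y]²) = AboveFloor-by y (x - + 3 * y) λ k<0 →
  RatioGtG1-by-gap y (- (x - + 3 * y)) (neg-mono-< k<0) 0<3x-7y 5y²<[2x-3y]² (solve (x ∷ y ∷ []))
  where
  open ≤-Reasoning
  5y<3t : + 5 * y < + 3 * (+ 2 * x - + 3 * y)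
  5y<3t = square-<⇒< (*-nonNeg (0≤+ 3) (<⇒≤ 0<2x-3y)) (begin-strict
    (+ 5 * y) * (+ 5 * y)   ≤⟨ ≤-by-gap (+ 20 * (y * y)) (*-nonNeg (0≤+ 20) (square-nonNeg y))
                                         (solve (x ∷ y ∷ [])) ⟩
    + 9 * (+ 5 * (y * y))   <⟨ *-monoˡ-<-pos (+ 9) 5y²<[2x-3y]² ⟩
    + 9 * ((+ 2 * x - + 3 * y) * (+ 2 * x - + 3 * y))
      ≡⟨ solve (x ∷ y ∷ []) ⟩
    (+ 3 * (+ 2 * x - + 3 * y)) * (+ 3 * (+ 2 * x - + 3 * y))   ∎)
  0<3x-7y : 0ℤ < + 2 * y - + 3 * (- (x - + 3 * y))
  0<3x-7y = half-pos _ (<-by-equal-gap {j′ = + 2 * (+ 2 * y - + 3 * (- (x - + 3 * y)))} 5y<3t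
                                       (solve (x ∷ y ∷ [])))

AboveFloor-step : ∀ {y k} → 0ℤ ≤ y → 0ℤ < k → (+ 2 * y + k) * (+ 2 * y + k) < + 5 * (k * k) →
                  AboveFloor y (k - + 2 * y)
AboveFloor-step {y} {k} 0≤y 0<k [2y+k]²<5k² = AboveFloor-by y (k - + 2 * y) λ k′<0 →
  RatioGtG1-by-gap y (- (k - + 2 * y)) (neg-mono-< k′<0) 0<3k-4y [2y+k]²<5k² (solve (y ∷ k ∷ []))
  where
  open ≤-Reasoning
  2[2y+k]<5k : + 2 * (+ 2 * y + k) < + 5 * k
  2[2y+k]<5k = square-<⇒< (*-nonNeg (0≤+ 5) (<⇒≤ 0<k)) (begin-strict
    (+ 2 * (+ 2 * y + k)) * (+ 2 * (+ 2 * y + k))  ≡⟨ solve (y ∷ k ∷ []) ⟩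
    + 4 * ((+ 2 * y + k) * (+ 2 * y + k))          <⟨ *-monoˡ-<-pos (+ 4) [2y+k]²<5k² ⟩
    + 4 * (+ 5 * (k * k))                          ≤⟨ ≤-by-gap (+ 5 * (k * k))
                                                        (*-nonNeg (0≤+ 5) (square-nonNeg k))
                                                        (solve (y ∷ k ∷ [])) ⟩
    (+ 5 * k) * (+ 5 * k)                          ∎)
  0<3k-4y : 0ℤ < + 2 * y - + 3 * (- (k - + 2 * y))
  0<3k-4y = <-by-equal-gap {i′ = 0ℤ} {j′ = + 2 * y - + 3 * (- (k - + 2 * y))} 2[2y+k]<5k
              (solve (y ∷ k ∷ []))

AboveFloor-start : ∀ s {x y z w} → InS s x y z w → AboveFloor y (x - smallest-digit s * y)
AboveFloor-start pos {x} {y} (_ , _ , _ , 1≤z , z≤x , r) =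
  subst (λ t → AboveFloor y (x - t)) (sym (*-identityˡ y))
        (AboveFloor-of-RatioGtg (≤-trans (0≤+ 1) (≤-trans 1≤z z≤x)) r)
AboveFloor-start neg {x} {y} (_ , _ , _ , _ , _ , r) = AboveFloor-of-RatioGtG1 {x} {y} r

digit-search : ∀ fuel {x y a e} → 0ℤ < y → Admissible (a , e) → AboveFloor y (x - a * y) →
               x - a * y ≤ + fuel → Σ ℤ λ a′ → Admissible (a′ , e) × Window y (x - a′ * y)
digit-search _ {a = a} _ adm (inj₂ r) _ = a , adm , inj₂ (inj₁ r)
digit-search fuel {x} {y} {a} {e} 0<y adm (inj₁ 0≤k) k≤fuel with <-cmp 0ℤ (x - a * y)
... | tri≈ _ 0≡k _ = a , adm , inj₂ (inj₂ (sym 0≡k))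
... | tri> _ _ k<0 = ⊥-elim (<⇒≱ k<0 0≤k)
... | tri< 0<k _ _ with + 5 * ((x - a * y) * (x - a * y)) <? (+ 2 * y + (x - a * y)) * (+ 2 * y + (x - a * y))
...   | yes 5k²<[2y+k]² = a , adm , inj₁ (0<k , 5k²<[2y+k]²)
...   | no  5k²≮[2y+k]² = continue fuel k≤fuel
  where
  k = x - a * y
  [2y+k]²<5k² : (+ 2 * y + k) * (+ 2 * y + k) < + 5 * (k * k)
  [2y+k]²<5k² =
    ≤∧≢⇒< (≮⇒≥ 5k²≮[2y+k]²) (λ eq → <⇒≢ 0<k (sym (√5-irrational (+ 2 * y + k) k eq)))
  shift : x - a * y - + 2 * y ≡ x - (a + + 2) * y
  shift = solve (x ∷ y ∷ a ∷ [])
  continue : ∀ fuel → k ≤ + fuel → Σ ℤ λ a′ → Admissible (a′ , e) × Window y (x - a′ * y)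
  continue zero    k≤0   = ⊥-elim (<⇒≱ 0<k k≤0)
  continue (suc f) k≤1+f =
    digit-search f {x} {y} {a + + 2} 0<y (Admissible-+2 adm)
      (subst (AboveFloor y) shift (AboveFloor-step (<⇒≤ 0<y) 0<k [2y+k]²<5k²))
      (<-≤-pred (<-by-gap {x - (a + + 2) * y} {x - a * y} (+ 2 * y) (*-pos {+ 2} (+<+ ℕ.z<s) 0<y)
                          (solve (x ∷ y ∷ a ∷ [])))
                k≤1+f)

smat-⊗-digitInv : ∀ s x y z w a →
                  smat s x y z w ⊗ digitInv (a , unit s) ≡ mat y (x - a * y) w (z - a * w)
smat-⊗-digitInv pos x y z w a = mat-cong (first x y) (second x y) (first z w) (second z w)
  where
  first : ∀ u v → u * 0ℤ + v * 1ℤ ≡ v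
  first u v = solve (u ∷ v ∷ [])
  second : ∀ u v → u * 1ℤ + v * - (a * 1ℤ) ≡ u - a * v
  second u v = solve (u ∷ v ∷ a ∷ [])
smat-⊗-digitInv neg x y z w a = mat-cong (first x y) (second x y) (first z w) (second z w)
  where
  first : ∀ u v → u * 0ℤ + - v * -1ℤ ≡ v
  first u v = solve (u ∷ v ∷ [])
  second : ∀ u v → u * 1ℤ + - v * - (a * -1ℤ) ≡ u - a * v
  second u v = solve (u ∷ v ∷ a ∷ [])

smat≡peeled⊗digit : ∀ s x y z w a →
                    smat s x y z w ≡ mat y (x - a * y) w (z - a * w) ⊗ digitMat (a , unit s)
smat≡peeled⊗digit s x y z w a =
  sym (mat-cong (first x y) (unit-column s y (x - a * y)) (first z w) (unit-column s w (z - a * w)))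
  where
  first : ∀ u v → v * a + (u - a * v) * 1ℤ ≡ u
  first u v = solve (u ∷ v ∷ a ∷ [])

-- Applied with (k, l, D) = ±(x − a y, z − a w, x w − y z), which satisfy y l = w k − D.
peeled-column-bounds : ∀ {y w k l D} → 0ℤ < y → 1ℤ ≤ w → w ≤ y → 0ℤ < k → IsUnit D →
                       (D ≡ -1ℤ → w < y) → y * l ≡ w * k - D → 0ℤ ≤ l × l ≤ k
peeled-column-bounds {y} {w} {k} {l} {D} 0<y 1≤w w≤y 0<k D-unit D≡-1⇒w<y yl≡wk-D =
  *-cancelˡ-≤-pos′ 0<y (subst₂ _≤_ (sym (*-zeroʳ y)) (sym yl≡wk-D) 0≤wk-D) ,
  *-cancelˡ-≤-pos′ 0<y (subst (_≤ y * k) (sym yl≡wk-D) (wk-D≤yk D-unit))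
  where
  0≤wk-D : 0ℤ ≤ w * k - D
  0≤wk-D = ≤-by-gap {0ℤ} {w * k - D} ((w - 1ℤ) * k + (k - 1ℤ) + (1ℤ - D))
    (+-nonNeg (+-nonNeg (*-nonNeg (i≤j⇒0≤j-i 1≤w) (<⇒≤ 0<k)) (i≤j⇒0≤j-i (i<j⇒suc[i]≤j 0<k)))
              (i≤j⇒0≤j-i (IsUnit⇒≤1 D-unit)))
    (solve (w ∷ k ∷ D ∷ []))
  wk-D≤yk : IsUnit D → w * k - D ≤ y * k
  wk-D≤yk (inj₁ refl) = ≤-by-gap {w * k - 1ℤ} {y * k} ((y - w) * k + 1ℤ)
    (+-nonNeg (*-nonNeg (i≤j⇒0≤j-i w≤y) (<⇒≤ 0<k)) (0≤+ 1)) (solve (y ∷ w ∷ k ∷ []))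
  wk-D≤yk (inj₂ refl) = ≤-by-gap {w * k - -1ℤ} {y * k} ((y - (1ℤ + w)) * k + (k - 1ℤ))
    (+-nonNeg (*-nonNeg (i≤j⇒0≤j-i (i<j⇒suc[i]≤j w<y)) (<⇒≤ 0<k)) (i≤j⇒0≤j-i (i<j⇒suc[i]≤j 0<k)))
    (solve (y ∷ w ∷ k ∷ []))
    where
    w<y = D≡-1⇒w<y refl

size-decreases-pos : ∀ {x y a} → 0ℤ ≤ y → 1ℤ ≤ a → RatioGtg y (x - a * y) →
                     y + + 2 * (x - a * y) < x + + 2 * y
size-decreases-pos {x} {y} {a} 0≤y 1≤a (0<k , 5k²<[2y+k]²) =
  <-by-gap (+ 2 * y + (x - a * y) - + 2 * (x - a * y) + (a - 1ℤ) * y)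
    (+-pos (i<j⇒0<j-i 2k<2y+k) (*-nonNeg (i≤j⇒0≤j-i 1≤a) 0≤y)) (solve (x ∷ y ∷ a ∷ []))
  where
  2k<2y+k : + 2 * (x - a * y) < + 2 * y + (x - a * y)
  2k<2y+k = square-<⇒< (+-nonNeg (*-nonNeg (0≤+ 2) 0≤y) (<⇒≤ 0<k))
                       (≤-<-trans (4y²≤5y² (x - a * y)) 5k²<[2y+k]²)

size-decreases-neg : ∀ {x y a} → 0ℤ ≤ y → 1ℤ ≤ a → RatioGtG1 y (- (x - a * y)) →
                     y + + 2 * (- (x - a * y)) < x + + 2 * y
size-decreases-neg {x} {y} {a} 0≤y 1≤a (_ , 0<2y-3κ , _) =
  <-by-gap (+ 2 * y - + 3 * (- (x - a * y)) + (a - 1ℤ) * y)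
    (+-pos 0<2y-3κ (*-nonNeg (i≤j⇒0≤j-i 1≤a) 0≤y)) (solve (x ∷ y ∷ a ∷ []))

-- k = 0 would force y = w = 1 and x = a, a matrix with no residue mod 2.
window-nonzero : ∀ s {x y z w a} → InS s x y z w → 1ℤ ≤ w → a ≡₂ 1ℤ → x - a * y ≢ 0ℤ
window-nonzero s {x} {y} {z} {w} {a} ((det-unit , residue) , _ , w≤y , _ , _ , r) 1≤w a-odd k≡0 =
  no-residue residue
  where
  open ≡-Reasoning
  D≡ : x * w - y * z ≡ y * (a * w - z)
  D≡ = begin
    x * w - y * z                          ≡⟨ solve (x ∷ y ∷ z ∷ w ∷ a ∷ []) ⟩
    y * (a * w - z) + w * (x - a * y)      ≡⟨ cong (λ t → y * (a * w - z) + w * t) k≡0 ⟩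
    y * (a * w - z) + w * 0ℤ               ≡⟨ solve (y ∷ z ∷ w ∷ a ∷ []) ⟩
    y * (a * w - z)                        ∎
  y≡1 : y ≡ 1ℤ
  y≡1 = positive-unit-factor (Ratio⇒0< s r) (IsUnit-resp D≡ (smat-det s x y z w det-unit))
  w≡1 : w ≡ 1ℤ
  w≡1 = ≤-antisym (subst (w ≤_) y≡1 w≤y) 1≤w
  x≡a : x ≡ a
  x≡a = begin
    x                    ≡⟨ solve (x ∷ y ∷ a ∷ []) ⟩
    (x - a * y) + a * y  ≡⟨ cong₂ (λ t u → t + a * u) k≡0 y≡1 ⟩
    0ℤ + a * 1ℤ          ≡⟨ solve (a ∷ []) ⟩
    a                    ∎
  no-residue : ReducesMod2 (smat s x y z w) → ⊥
  no-residue (inj₁ (_ , y≡0 , _ , _))        = odd≢₂even (signed s y) (signed-one s y≡1) y≡0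
  no-residue (inj₂ (inj₁ (x≡0 , _ , _ , _))) = odd≢₂even x (subst (_≡₂ 1ℤ) (sym x≡a) a-odd) x≡0
  no-residue (inj₂ (inj₂ (_ , _ , _ , w≡0))) = odd≢₂even (signed s w) (signed-one s w≡1) w≡0

peeled-Γ̃ : ∀ s {x y z w a} → InΓ̃ (smat s x y z w) → a ≡₂ 1ℤ →
           InΓ̃ (mat y (x - a * y) w (z - a * w))
peeled-Γ̃ s {x} {y} {z} {w} {a} γ a-odd =
  subst InΓ̃ (smat-⊗-digitInv s x y z w a)
    (InΓ̃-⊗ (smat s x y z w) (digitInv (a , unit s)) γ (digitInv-Γ̃ {a} {unit s} a-odd (unit-IsUnit s)))

smat-neg-neg : ∀ x y z w → smat neg x (- y) z (- w) ≡ mat x y z w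
smat-neg-neg x y z w = mat-cong refl (neg-involutive y) refl (neg-involutive w)

Peeled : Sign → ℤ → ℤ → ℤ → ℤ → ℤ → Set
Peeled s x y z w a = Σ Sign λ s′ → Σ ℤ λ x′ → Σ ℤ λ z′ →
  (smat s x y z w ≡ smat s′ y x′ w z′ ⊗ digitMat (a , unit s)) × InS s′ y x′ w z′ ×
  (y + + 2 * x′ < x + + 2 * y)

peel : ∀ s {x y z w a} → InS s x y z w → 1ℤ ≤ w → Admissible (a , unit s) → Window y (x - a * y) →
       Peeled s x y z w a
peel s {x} {y} {z} {w} {a} inS@(γ , _ , w≤y , _ , z≤x , r) 1≤w adm = from-window
  where
  a-odd = Admissible⇒odd {a} {unit s} adm
  1≤a = Admissible⇒1≤ {a} {unit s} adm
  0<y = Ratio⇒0< s r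
  D-unit = smat-det s x y z w (proj₁ γ)
  M≡M′⊗D = smat≡peeled⊗digit s x y z w a
  M′-Γ̃ = peeled-Γ̃ s {x} {y} {z} {w} {a} γ a-odd
  D-at-w≡y = det-at-w≡y {x} {y} {z} {w}

  from-window : Window y (x - a * y) → Peeled s x y z w a
  from-window (inj₁ r′) =
    pos , x - a * y , z - a * w , M≡M′⊗D ,
    (M′-Γ̃ , proj₁ bounds , proj₂ bounds , 1≤w , w≤y , r′) ,
    size-decreases-pos {x} {y} {a} (<⇒≤ 0<y) 1≤a r′
    where
    w<y : x * w - y * z ≡ -1ℤ → w < y
    w<y D≡-1 = ≤∧≢⇒< w≤y λ w≡y →
      <⇒≱ -<+ (subst (0ℤ ≤_) (trans (sym (D-at-w≡y w≡y)) D≡-1) (*-nonNeg (<⇒≤ 0<y) (i≤j⇒0≤j-i z≤x)))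
    bounds = peeled-column-bounds {k = x - a * y} {l = z - a * w} {D = x * w - y * z}
               0<y 1≤w w≤y (proj₁ r′) D-unit w<y (solve (x ∷ y ∷ z ∷ w ∷ a ∷ []))
  from-window (inj₂ (inj₁ r′@(0<κ , 0<2y-3κ , _))) =
    neg , - (x - a * y) , - (z - a * w) ,
    trans M≡M′⊗D (cong (_⊗ digitMat (a , unit s)) (sym M′≡)) ,
    (subst InΓ̃ (sym M′≡) M′-Γ̃ , proj₁ bounds , proj₂ bounds , 1≤w , w≤y , r′) ,
    size-decreases-neg {x} {y} {a} (<⇒≤ 0<y) 1≤a r′
    where
    M′≡ = smat-neg-neg y (x - a * y) w (z - a * w)
    -- w = y would give y (x − z) = 1, so y = 1, and then y/κ ≤ 1 < G + 1.
    w<y : - (x * w - y * z) ≡ -1ℤ → w < y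
    w<y -D≡-1 = ≤∧≢⇒< w≤y λ w≡y →
      <⇒≱ (subst (λ t → 0ℤ < + 2 * t - + 3 * (- (x - a * y))) (y≡1 w≡y) 0<2y-3κ)
          (≤-by-gap (+ 3 * (- (x - a * y) - 1ℤ) + 1ℤ)
                    (+-nonNeg (*-nonNeg (0≤+ 3) (i≤j⇒0≤j-i (i<j⇒suc[i]≤j 0<κ))) (0≤+ 1))
                    (solve (x ∷ y ∷ a ∷ [])))
      where
      y≡1 : w ≡ y → y ≡ 1ℤ
      y≡1 w≡y = positive-unit-factor {y} {x - z} 0<y
        (inj₁ (trans (sym (D-at-w≡y w≡y)) (trans (sym (neg-involutive (x * w - y * z))) (cong -_ -D≡-1))))
    bounds = peeled-column-bounds {k = - (x - a * y)} {l = - (z - a * w)} {D = - (x * w - y * z)}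
               0<y 1≤w w≤y 0<κ (IsUnit-neg D-unit) w<y (solve (x ∷ y ∷ z ∷ w ∷ a ∷ []))
  from-window (inj₂ (inj₂ k≡0)) = ⊥-elim (window-nonzero s {x} {y} {z} {w} {a} inS 1≤w a-odd k≡0)

-- For w = 0 the determinant is ∓ y z, so y = z = 1 and the matrix is the digit (x, s).
single-digit : ∀ s {x y z} → InS s x y z 0ℤ → Inℙ (smat s x y z 0ℤ)
single-digit s {x} {y} {z} ((det-unit , residue) , _ , _ , 1≤z , z≤x , r) =
  (x , unit s) , [] , (x-odd-form , unit-IsUnit s , 2≤x+e s r x-odd-form) , All.[] ,
  trans (cong₂ (λ y z → smat s x y z 0ℤ) y≡1 z≡1) (sym (digit≡smat s x))
  where
  yz-unit : IsUnit (y * z)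
  yz-unit = IsUnit-resp {i = - (x * 0ℤ - y * z)} {j = y * z} (solve (x ∷ y ∷ z ∷ []))
              (IsUnit-neg (smat-det s x y z 0ℤ det-unit))
  y≡1 = positive-unit-factor (Ratio⇒0< s r) yz-unit
  z≡1 = positive-unit-factor {z} {y} (<-≤-trans (+<+ ℕ.z<s) 1≤z) (IsUnit-resp (*-comm y z) yz-unit)
  0≢₂1 : ¬ (signed s 0ℤ ≡₂ 1ℤ)
  0≢₂1 h = toWitnessFalse {a? = 0ℤ ≡₂? 1ℤ} tt (subst (_≡₂ 1ℤ) (signed-zero s) h)
  x-odd : ReducesMod2 (smat s x y z 0ℤ) → x ≡₂ 1ℤ
  x-odd (inj₁ (_ , _ , _ , 0≡1))        = ⊥-elim (0≢₂1 0≡1)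
  x-odd (inj₂ (inj₁ (_ , _ , _ , 0≡1))) = ⊥-elim (0≢₂1 0≡1)
  x-odd (inj₂ (inj₂ (x≡1 , _)))         = x≡1
  x-odd-form = odd-form-of (≤-trans 1≤z z≤x) (x-odd residue)
  2≤x+e : ∀ s → Ratio s x y → (∃ λ k → x ≡ + (2 ℕ.* k ℕ.+ 1)) → + 2 ≤ x + unit s
  2≤x+e pos _ _ = +-monoˡ-≤ 1ℤ (≤-trans 1≤z z≤x)
  2≤x+e neg (_ , 0<2x-3y , _) (zero , x≡1) =
    ⊥-elim (<⇒≱ (subst₂ (λ u v → 0ℤ < + 2 * u - + 3 * v) x≡1 y≡1 0<2x-3y) -≤+)
  2≤x+e neg _ (suc k , x≡2k+3) =
    ≤-by-gap (+ 2 * + k) (*-nonNeg (0≤+ 2) (0≤+ k))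
      (trans (cong (_+ -1ℤ) (trans x≡2k+3 (odd-form (suc k)))) (shift (+ k)))
    where
    shift : ∀ t → + 2 * (1ℤ + t) + 1ℤ + -1ℤ ≡ + 2 + + 2 * t
    shift = solve-∀

InS⇒ℙ : ∀ fuel s {x y z w} → x + + 2 * y ≤ + fuel → InS s x y z w → Inℙ (smat s x y z w)
InS⇒ℙ zero s {x} {y} size≤0 (_ , 0≤w , w≤y , 1≤z , z≤x , _) =
  ⊥-elim (<⇒≱ (+-pos (<-≤-trans (+<+ ℕ.z<s) (≤-trans 1≤z z≤x)) (*-nonNeg (0≤+ 2) (≤-trans 0≤w w≤y)))
               size≤0)
InS⇒ℙ (suc fuel) s {x} {y} {z} {w} size≤ inS@(_ , 0≤w , _ , _ , _ , r) with <-cmp 0ℤ w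
... | tri> _ _ w<0 = ⊥-elim (<⇒≱ w<0 0≤w)
... | tri≈ _ refl _ = single-digit s inS
... | tri< 0<w _ _
  with digit-search ∣ x - smallest-digit s * y ∣ {x} {y} (Ratio⇒0< s r) (smallest-digit-Admissible s)
         (AboveFloor-start s inS) (i≤+∣i∣ _)
...   | a , adm , window with peel s inS (i<j⇒suc[i]≤j 0<w) adm window
...     | s′ , x′ , z′ , M≡M′⊗D , inS′ , smaller =
  subst Inℙ (sym M≡M′⊗D) (Inℙ-⊗-digit (InS⇒ℙ fuel s′ (<-≤-pred smaller size≤) inS′) adm)

lemma9 : (M : Defs.Mat) → (Inℙ M → InS₊ M ⊎ InS₋ M) × (InS₊ M ⊎ InS₋ M → Inℙ M)
lemma9 M = Invariant⇒𝒮 ∘ ℙ⇒Invariant , 𝒮⇒ℙ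
  where
  𝒮⇒ℙ : InS₊ M ⊎ InS₋ M → Inℙ M
  𝒮⇒ℙ (inj₁ inS) = InS⇒ℙ ∣ a M + + 2 * b M ∣ pos (i≤+∣i∣ _) inS
  𝒮⇒ℙ (inj₂ (x , y , z , w , refl , inS)) = InS⇒ℙ ∣ x + + 2 * y ∣ neg (i≤+∣i∣ _) inS
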